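{- Let $(A_1,B_1,C_1),(A_2,B_2,C_2)\in\mathcal{S}_n(\mathbb{Z})$, put $\alpha_j=B_j+C_j\omega$, and let $e$ be the positive integer with $e^n=\gcd(B_1B_2+mC_1C_2,\ B_1C_2+B_2C_1+\sigma C_1C_2)$ (equivalently $e=N(\mathfrak{e})$ where $(\alpha_1)+(\alpha_2')=\mathfrak{e}^n$). Define $$A_3=\frac{A_1A_2}{e^2},\qquad B_3=\frac{B_1B_2+mC_1C_2}{e^n},\qquad C_3=\frac{B_1C_2+B_2C_1+\sigma C_1C_2}{e^n}.$$ Then $(A_1,B_1,C_1)\oplus(A_2,B_2,C_2)=(A_3,B_3,C_3)$; that is, $(A_3,B_3,C_3)\in\mathcal{S}_n(\mathbb{Z})$ and $(B_3+C_3\omega)\mathbb{N}^n=\alpha_1\mathbb{N}^n\cdot\alpha_2\mathbb{N}^n$ in $\mathcal{O}^*/\mathbb{N}^n$.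
   Context: $\Delta$ is a fundamental discriminant, $\Delta=4m+\sigma$ with $\sigma\in\{0,1\}$; $\mathcal{O}=\mathbb{Z}[\omega]$ with $\omega=(\sigma+\sqrt{\Delta})/2$ is the ring of integers of $\mathbb{Q}(\sqrt{\Delta})$; $Q_0(x,y)=x^2+\sigma xy-my^2=N(x+y\omega)$. For fixed $n\ge2$, $\mathcal{S}_n(\mathbb{Z})$ is the set of integer triples $(A,B,C)$ with $Q_0(B,C)=A^n$, $\gcd(B,C)=1$. $\mathcal{O}^*/\mathbb{N}^n$ is the group of classes of nonzero elements of $\mathcal{O}$ under $\alpha\sim\beta$ iff $a^n\alpha=b^n\beta$ for some positive integers $a,b$, with multiplication induced from $\mathcal{O}$; the class of $\alpha$ is written $\alpha\mathbb{N}^n$. The group law $\oplus$ on $\mathcal{S}_n(\mathbb{Z})$ is defined by transport of structure via the map $\pi(A,B,C)=(B+C\omega)\mathbb{N}^n$: $P_1\oplus P_2$ is the point $P_3$ with $\pi(P_3)=\pi(P_1)\pi(P_2)$. -}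

module Defs where

open import Data.Nat as ℕ using (ℕ)
open import Data.Nat.Divisibility as ℕD using ()
open import Data.Integer using (ℤ; +_; _+_; _-_; _*_; _^_; ∣_∣; 0ℤ; 1ℤ)
open import Data.Integer.GCD using (gcd)
open import Data.Product using (Σ; _×_; _,_; ∃; ∃-syntax)
open import Data.Sum using (_⊎_)
open import Relation.Binary.PropositionalEquality using (_≡_; _≢_)

SquarefreeNat : ℕ → Set
SquarefreeNat k = ∀ (d : ℕ) → (d ℕ.* d) ℕD.∣ k → d ≡ 1

IsFundamentalDiscriminant : ℤ → Set
IsFundamentalDiscriminant Δ =
  Δ ≢ 1ℤ ×
  ( ((∃[ t ] Δ ≡ + 4 * t + 1ℤ) × SquarefreeNat ∣ Δ ∣)
  ⊎ (∃[ k ] (Δ ≡ + 4 * k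
             × ((∃[ t ] k ≡ + 4 * t + + 2) ⊎ (∃[ t ] k ≡ + 4 * t + + 3))
             × SquarefreeNat ∣ k ∣)) )

Disc : ℤ → ℤ → ℤ
Disc m σ = + 4 * m + σ

-- Q₀(x,y) = x² + σxy − my² = N(x + yω)
Q₀ : ℤ → ℤ → ℤ → ℤ → ℤ
Q₀ m σ x y = x * x + σ * x * y - m * y * y

InS : ℕ → ℤ → ℤ → ℤ → ℤ → ℤ → Set
InS n m σ A B C = Q₀ m σ B C ≡ A ^ n × gcd B C ≡ 1ℤ

-- Elements x + yω of 𝒪 = ℤ[ω], represented by the pair (x , y).
𝒪 : Set
𝒪 = ℤ × ℤ

-- Multiplication in 𝒪, using ω² = σω + m.
mul𝒪 : ℤ → ℤ → 𝒪 → 𝒪 → 𝒪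
mul𝒪 m σ (x₁ , y₁) (x₂ , y₂) =
  (x₁ * x₂ + m * y₁ * y₂ , x₁ * y₂ + x₂ * y₁ + σ * y₁ * y₂)

scale : ℤ → 𝒪 → 𝒪
scale k (x , y) = (k * x , k * y)

-- α 𝐍ⁿ = β 𝐍ⁿ in 𝒪*/𝐍ⁿ : aⁿ α = bⁿ β for some positive integers a, b.
SameClass : ℕ → 𝒪 → 𝒪 → Set
SameClass n α β =
  Σ ℕ λ a → Σ ℕ λ b → 1 ℕ.≤ a × 1 ℕ.≤ b ×
    scale (+ (a ℕ.^ n)) α ≡ scale (+ (b ℕ.^ n)) β

{-# OPTIONS --safe #-}

-- Let αⱼ = Bⱼ + Cⱼω, α₁α₂ = X + Yω, g = gcd(X, Y) and d = gcd(A₁, A₂, Y).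
-- Since Δ is fundamental and n ≥ 2, Δ is prime to each Aⱼ: its squarefree part would
-- otherwise meet Aⱼ² ∣ (2Bⱼ + σCⱼ)² − ΔCⱼ², and when σ = 0 the factor 4 is excluded
-- modulo 4.  Hence 2B₁ + σC₁, and with it B₁C₂ − B₂C₁, is prime to d, and the identities
-- (B₁C₂ − B₂C₁)Y = C₂²N(α₁) − C₁²N(α₂) and C₁X = B₁Y − C₂N(α₁) give dⁿ ∣ g.  Conversely
-- g divides Y and, multiplying α₁α₂ by a conjugate, both norms A₁ⁿ and A₂ⁿ, so g ∣ dⁿ.
-- Thus g = eⁿ with e = |d| dividing A₁ and A₂, and (X + Yω)/g is a primitive element of
-- norm (A₁A₂/e²)ⁿ.
module Submission where

open import Defs
open import Data.Nat as ℕ using (ℕ)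
open import Data.Integer using (ℤ; +_; _+_; _*_; 0ℤ; 1ℤ)
open import Data.Integer.GCD using (gcd)
open import Data.Product using (Σ; _×_; _,_)
open import Data.Sum using (_⊎_)
open import Relation.Binary.PropositionalEquality using (_≡_)

open import Data.Nat using (zero; suc; s≤s; z≤n)
import Data.Nat.Properties as ℕP
import Data.Nat.Divisibility as ℕD
import Data.Nat.GCD as ℕG
open import Data.Integer using (-[1+_]; _-_; _^_; -_; ∣_∣; -1ℤ; ≢-nonZero)
import Data.Integer as ℤ
import Data.Integer.Properties as ℤP
import Data.Integer.DivMod as ℤDM
import Data.Integer.GCD as ℤG
open import Data.Integer.Divisibility.Signed
open import Data.Integer.Tactic.RingSolver using (solve-∀)
open import Data.Product using (∃; ∃₂; ∃-syntax)
open import Data.Sum using (inj₁; inj₂; [_,_]′)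
open import Data.Empty using (⊥; ⊥-elim)
open import Relation.Nullary using (¬_; Dec; yes; no)
open import Relation.Nullary.Decidable using (from-no)
open import Relation.Binary.Definitions using (tri<; tri≈; tri>)
open import Relation.Binary.PropositionalEquality
  using (_≢_; refl; sym; trans; cong; cong₂; subst; subst₂; module ≡-Reasoning)

-- Coprimality in Bézout form: over ℤ it is equivalent to Data.Integer.Coprimality.Coprime,
-- and it is the form in which the ring solver can manipulate it.
Coprime : ℤ → ℤ → Set
Coprime a b = ∃₂ λ u v → u * a + v * b ≡ 1ℤ

coprime-sym : ∀ {a b} → Coprime a b → Coprime b a
coprime-sym {a} {b} (u , v , eq) = v , u , trans (ℤP.+-comm (v * b) (u * a)) eq

coprime-∣ʳ : ∀ {a b c} → Coprime a b → c ∣ b → Coprime a c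
coprime-∣ʳ {a} {c = c} (u , v , eq) (divides q refl) =
  u , v * q , trans (cong (λ w → u * a + w) (ℤP.*-assoc v q c)) eq

coprime-*ˡ : ∀ {a b c} → Coprime a c → Coprime b c → Coprime (a * b) c
coprime-*ˡ {a} {b} {c} (u , v , eq) (u′ , v′ , eq′) =
  u * u′ , u * a * v′ + v * (u′ * b + v′ * c) ,
  trans (sym (expand u a v c u′ b v′)) (cong₂ _*_ eq eq′)
  where
  expand : ∀ u a v c u′ b v′ → (u * a + v * c) * (u′ * b + v′ * c)
         ≡ u * u′ * (a * b) + (u * a * v′ + v * (u′ * b + v′ * c)) * c
  expand = solve-∀

coprime-*⇒coprimeˡ : ∀ {a b c} → Coprime (a * b) c → Coprime a c
coprime-*⇒coprimeˡ {a} {b} {c} (u , v , eq) =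
  u * b , v , trans (cong (_+ v * c) (regroup u a b)) eq
  where
  regroup : ∀ u a b → u * b * a ≡ u * (a * b)
  regroup = solve-∀

coprime-^ˡ : ∀ {a c} k → Coprime a c → Coprime (a ^ k) c
coprime-^ˡ zero    _   = 1ℤ , 0ℤ , refl
coprime-^ˡ (suc k) a⊥c = coprime-*ˡ a⊥c (coprime-^ˡ k a⊥c)

coprime-^ʳ : ∀ {a c} k → Coprime a c → Coprime a (c ^ k)
coprime-^ʳ k a⊥c = coprime-sym (coprime-^ˡ k (coprime-sym a⊥c))

coprime-squares : ∀ {a b} → Coprime a b → Coprime (a * a) (b * b)
coprime-squares {a} {b} a⊥b = coprime-*ˡ a⊥b² a⊥b²
  where
  a⊥b² : Coprime a (b * b)
  a⊥b² = coprime-sym (coprime-*ˡ (coprime-sym a⊥b) (coprime-sym a⊥b))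

coprime-+∣ : ∀ {a t c} → Coprime a c → c ∣ t → Coprime (a + t) c
coprime-+∣ {a} {c = c} (u , v , eq) (divides q refl) =
  u , v - u * q , trans (shift u a q c v) eq
  where
  shift : ∀ u a q c v → u * (a + q * c) + (v - u * q) * c ≡ u * a + v * c
  shift = solve-∀

coprime-factors : ∀ {s t c h} → Coprime s t → c ∣ h * s → c ∣ h * t → c ∣ h
coprime-factors {s} {t} {c} {h} (u , v , eq) c∣hs c∣ht =
  subst (c ∣_) h≡ (∣m∣n⇒∣m+n (∣n⇒∣m*n u c∣hs) (∣n⇒∣m*n v c∣ht))
  where
  open ≡-Reasoning
  regroup : ∀ u s v t h → u * (h * s) + v * (h * t) ≡ h * (u * s + v * t)
  regroup = solve-∀
  h≡ : u * (h * s) + v * (h * t) ≡ h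
  h≡ = begin
    u * (h * s) + v * (h * t) ≡⟨ regroup u s v t h ⟩
    h * (u * s + v * t)       ≡⟨ cong (h *_) eq ⟩
    h * 1ℤ                    ≡⟨ ℤP.*-identityʳ h ⟩
    h                         ∎

coprime-divisor : ∀ {a b z} → Coprime a b → a ∣ b * z → a ∣ z
coprime-divisor {a} {b} {z} a⊥b a∣bz =
  coprime-factors a⊥b (∣n⇒∣m*n z ∣-refl) (subst (a ∣_) (ℤP.*-comm b z) a∣bz)

coprime[a,0]⇒∣a∣≡1 : ∀ {a} → Coprime a 0ℤ → ∣ a ∣ ≡ 1
coprime[a,0]⇒∣a∣≡1 {a} (u , v , eq) =
  ℕP.m*n≡1⇒n≡1 ∣ u ∣ ∣ a ∣ (trans (sym (ℤP.abs-* u a)) (cong ∣_∣ ua≡1))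
  where
  ua≡1 : u * a ≡ 1ℤ
  ua≡1 = trans (sym (trans (cong (λ w → u * a + w) (ℤP.*-zeroʳ v)) (ℤP.+-identityʳ (u * a)))) eq

gcd∣ˡ : ∀ a b → gcd a b ∣ a
gcd∣ˡ a b = ∣ᵤ⇒∣ (ℤG.gcd[i,j]∣i a b)

gcd∣ʳ : ∀ a b → gcd a b ∣ b
gcd∣ʳ a b = ∣ᵤ⇒∣ (ℤG.gcd[i,j]∣j a b)

gcd-greatest : ∀ {a b c} → c ∣ a → c ∣ b → c ∣ gcd a b
gcd-greatest {a} {b} {c} c∣a c∣b = ∣ᵤ⇒∣ (ℤG.gcd-greatest {a} {b} {c} (∣⇒∣ᵤ c∣a) (∣⇒∣ᵤ c∣b))

abs-as-multiple : ∀ i → ∃ λ s → + ∣ i ∣ ≡ s * i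
abs-as-multiple (+ n)    = 1ℤ , sym (ℤP.*-identityˡ (+ n))
abs-as-multiple -[1+ n ] = -1ℤ , sym (ℤP.-1*i≡-i -[1+ n ])

ℕ-identity⇒ℤ : ∀ {d} x a y b → d ℕ.+ y ℕ.* b ≡ x ℕ.* a → + x * + a - + y * + b ≡ + d
ℕ-identity⇒ℤ {d} x a y b eq = begin
  + x * + a - + y * + b              ≡⟨ cong₂ _-_ (sym (ℤP.pos-* x a)) (sym (ℤP.pos-* y b)) ⟩
  + (x ℕ.* a) - + (y ℕ.* b)          ≡⟨ cong (_- + (y ℕ.* b)) (cong +_ (sym eq)) ⟩
  + (d ℕ.+ y ℕ.* b) - + (y ℕ.* b)    ≡⟨ cong (_- + (y ℕ.* b)) (ℤP.pos-+ d (y ℕ.* b)) ⟩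
  + d + + (y ℕ.* b) - + (y ℕ.* b)    ≡⟨ cancel (+ d) (+ (y ℕ.* b)) ⟩
  + d                                ∎
  where
  open ≡-Reasoning
  cancel : ∀ p q → p + q - q ≡ p
  cancel = solve-∀

ℕ-bézout : ∀ a b → ∃₂ λ u v → u * + a + v * + b ≡ + ℕG.gcd a b
ℕ-bézout a b with ℕG.Bézout.identity (ℕG.gcd-GCD a b)
... | ℕG.Bézout.+- x y eq =
  + x , - + y , trans (minus (+ x) (+ a) (+ y) (+ b)) (ℕ-identity⇒ℤ x a y b eq)
  where
  minus : ∀ x a y b → x * a + - y * b ≡ x * a - y * b
  minus = solve-∀
... | ℕG.Bézout.-+ x y eq =
  - + x , + y , trans (minus (+ x) (+ a) (+ y) (+ b)) (ℕ-identity⇒ℤ y b x a eq)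
  where
  minus : ∀ x a y b → - x * a + y * b ≡ y * b - x * a
  minus = solve-∀

gcd-bézout : ∀ i j → ∃₂ λ u v → u * i + v * j ≡ gcd i j
gcd-bézout i j with ℕ-bézout ∣ i ∣ ∣ j ∣ | abs-as-multiple i | abs-as-multiple j
... | u , v , eq | s , ∣i∣≡si | t , ∣j∣≡tj = u * s , v * t , (begin
  u * s * i + v * t * j       ≡⟨ regroup u s i v t j ⟩
  u * (s * i) + v * (t * j)   ≡⟨ cong₂ (λ p q → u * p + v * q) (sym ∣i∣≡si) (sym ∣j∣≡tj) ⟩
  u * + ∣ i ∣ + v * + ∣ j ∣   ≡⟨ eq ⟩
  gcd i j                     ∎)
  where
  open ≡-Reasoning
  regroup : ∀ u s i v t j → u * s * i + v * t * j ≡ u * (s * i) + v * (t * j)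
  regroup = solve-∀

gcd≡1⇒coprime : ∀ {a b} → gcd a b ≡ 1ℤ → Coprime a b
gcd≡1⇒coprime {a} {b} eq = let u , v , bézout = gcd-bézout a b in u , v , trans bézout eq

coprime⇒gcd≡1 : ∀ {a b} → Coprime a b → gcd a b ≡ 1ℤ
coprime⇒gcd≡1 {a} {b} (u , v , eq) =
  cong +_ (ℕD.∣1⇒≡1 (∣⇒∣ᵤ (subst (gcd a b ∣_) eq g∣ua+vb)))
  where
  g∣ua+vb : gcd a b ∣ u * a + v * b
  g∣ua+vb = ∣m∣n⇒∣m+n (∣n⇒∣m*n u (gcd∣ˡ a b)) (∣n⇒∣m*n v (gcd∣ʳ a b))

gcd-quotients : ∀ a b → gcd a b ≢ 0ℤ →
  ∃₂ λ a′ b′ → a ≡ a′ * gcd a b × b ≡ b′ * gcd a b × Coprime a′ b′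
gcd-quotients a b g≢0 =
  let divides a′ a≡ = gcd∣ˡ a b
      divides b′ b≡ = gcd∣ʳ a b
      u , v , eq    = gcd-bézout a b
      open ≡-Reasoning
  in a′ , b′ , a≡ , b≡ , u , v ,
     ℤP.*-cancelʳ-≡ _ _ (gcd a b) {{≢-nonZero g≢0}} (begin
       (u * a′ + v * b′) * gcd a b              ≡⟨ regroup u a′ v b′ (gcd a b) ⟩
       u * (a′ * gcd a b) + v * (b′ * gcd a b)  ≡⟨ cong₂ (λ p q → u * p + v * q) a≡ b≡ ⟨
       u * a + v * b                            ≡⟨ eq ⟩
       gcd a b                                  ≡⟨ ℤP.*-identityˡ (gcd a b) ⟨
       1ℤ * gcd a b                             ∎)
  where
  regroup : ∀ u a′ v b′ g → (u * a′ + v * b′) * g ≡ u * (a′ * g) + v * (b′ * g)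
  regroup = solve-∀

^-distribʳ-* : ∀ x y k → (x * y) ^ k ≡ x ^ k * y ^ k
^-distribʳ-* x y zero    = refl
^-distribʳ-* x y (suc k) = trans (cong (x * y *_) (^-distribʳ-* x y k)) (swap x y (x ^ k) (y ^ k))
  where
  swap : ∀ x y p q → x * y * (p * q) ≡ x * p * (y * q)
  swap = solve-∀

pos-^ : ∀ a k → (+ a) ^ k ≡ + (a ℕ.^ k)
pos-^ a zero    = refl
pos-^ a (suc k) = trans (cong (+ a *_) (pos-^ a k)) (sym (ℤP.pos-* a (a ℕ.^ k)))

∣-^ : ∀ {a b} k → a ∣ b → a ^ k ∣ b ^ k
∣-^ zero    _   = ∣-refl
∣-^ {a} {b} (suc k) a∣b = ∣-trans (*-monoʳ-∣ a (∣-^ k a∣b)) (*-monoˡ-∣ (b ^ k) a∣b)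

a∣a^[1+k] : ∀ a k → a ∣ a ^ suc k
a∣a^[1+k] a k = ∣m⇒∣m*n (a ^ k) ∣-refl

a*a∣a^[2+k] : ∀ a k → a * a ∣ a ^ suc (suc k)
a*a∣a^[2+k] a k = divides (a ^ k) (regroup a (a ^ k))
  where
  regroup : ∀ a p → a * (a * p) ≡ p * (a * a)
  regroup = solve-∀

∣gcd-^ : ∀ {c a b} k → c ∣ a ^ k → c ∣ b ^ k → c ∣ gcd a b ^ k
∣gcd-^ {c} {a} {b} k c∣aᵏ c∣bᵏ = by-cases (g ℤ.≟ 0ℤ)
  where
  g : ℤ
  g = gcd a b
  power-of-multiple : ∀ {x x′} → x ≡ x′ * g → x ^ k ≡ g ^ k * x′ ^ k
  power-of-multiple {x′ = x′} refl = trans (^-distribʳ-* x′ g k) (ℤP.*-comm (x′ ^ k) (g ^ k))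
  by-cases : Dec (g ≡ 0ℤ) → c ∣ g ^ k
  by-cases (yes g≡0) = subst (λ z → c ∣ z ^ k) (trans (ℤG.gcd[i,j]≡0⇒i≡0 a b g≡0) (sym g≡0)) c∣aᵏ
  by-cases (no g≢0)  =
    let a′ , b′ , a≡ , b≡ , a′⊥b′ = gcd-quotients a b g≢0
    in coprime-factors (coprime-^ʳ k (coprime-^ˡ k a′⊥b′))
         (subst (c ∣_) (power-of-multiple a≡) c∣aᵏ)
         (subst (c ∣_) (power-of-multiple b≡) c∣bᵏ)

h²∣squarefree⇒∣h∣≡1 : ∀ {P h} → SquarefreeNat ∣ P ∣ → h * h ∣ P → ∣ h ∣ ≡ 1
h²∣squarefree⇒∣h∣≡1 {P} {h} sf hh∣P = sf ∣ h ∣ (subst (ℕD._∣ ∣ P ∣) (ℤP.abs-* h h) (∣⇒∣ᵤ hh∣P))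

squarefree⇒≢0 : ∀ {P} → SquarefreeNat ∣ P ∣ → P ≢ 0ℤ
squarefree⇒≢0 sf refl with sf 2 (ℕD._∣0 4)
... | ()

∣squarefree⇒∣x²⇒∣x : ∀ {P h x} → SquarefreeNat ∣ P ∣ → h ∣ P → h ∣ x * x → h ∣ x
∣squarefree⇒∣x²⇒∣x {P} {h} {x} sf h∣P h∣xx = by-cases (g ℤ.≟ 0ℤ)
  where
  g : ℤ
  g = gcd h x
  regroup : ∀ x′ g → x′ * g * (x′ * g) ≡ x′ * x′ * g * g
  regroup = solve-∀
  from-quotients : g ≢ 0ℤ → (∃₂ λ h′ x′ → h ≡ h′ * g × x ≡ x′ * g × Coprime h′ x′) → h ∣ x
  from-quotients g≢0 (h′ , x′ , h≡ , x≡ , h′⊥x′) =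
    ∣ᵤ⇒∣ (subst (ℕD._∣ ∣ x ∣) (sym ∣h∣≡∣g∣) (∣⇒∣ᵤ (gcd∣ʳ h x)))
    where
    x′⊥h′ : Coprime x′ h′
    x′⊥h′ = coprime-sym h′⊥x′
    h′∣g : h′ ∣ g
    h′∣g = coprime-divisor (coprime-sym (coprime-*ˡ x′⊥h′ x′⊥h′))
      (*-cancelʳ-∣ g {{≢-nonZero g≢0}}
        (subst₂ _∣_ h≡ (trans (cong (λ z → z * z) x≡) (regroup x′ g)) h∣xx))
    ∣h′∣≡1 : ∣ h′ ∣ ≡ 1
    ∣h′∣≡1 = h²∣squarefree⇒∣h∣≡1 {P} {h′} sf
      (∣-trans (subst (h′ * h′ ∣_) (sym h≡) (*-monoʳ-∣ h′ h′∣g)) h∣P)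
    ∣h∣≡∣g∣ : ∣ h ∣ ≡ ∣ g ∣
    ∣h∣≡∣g∣ = begin
      ∣ h ∣            ≡⟨ cong ∣_∣ h≡ ⟩
      ∣ h′ * g ∣       ≡⟨ ℤP.abs-* h′ g ⟩
      ∣ h′ ∣ ℕ.* ∣ g ∣ ≡⟨ cong (ℕ._* ∣ g ∣) ∣h′∣≡1 ⟩
      1 ℕ.* ∣ g ∣      ≡⟨ ℕP.*-identityˡ ∣ g ∣ ⟩
      ∣ g ∣            ∎
      where open ≡-Reasoning
  by-cases : Dec (g ≡ 0ℤ) → h ∣ x
  by-cases (yes g≡0) =
    ⊥-elim (squarefree⇒≢0 sf (0∣⇒≡0 (subst (_∣ P) (ℤG.gcd[i,j]≡0⇒i≡0 h x g≡0) h∣P)))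
  by-cases (no g≢0) = from-quotients g≢0 (gcd-quotients h x g≢0)

a²∣x²-Pc²⇒coprime[P,a] : ∀ {P a c x} → SquarefreeNat ∣ P ∣ → Coprime c a →
                          a * a ∣ x * x - P * (c * c) → Coprime P a
a²∣x²-Pc²⇒coprime[P,a] {P} {a} {c} {x} sf c⊥a aa∣M =
  gcd≡1⇒coprime (cong +_ (h²∣squarefree⇒∣h∣≡1 {P} {h} sf hh∣P))
  where
  h : ℤ
  h = gcd P a
  M : ℤ
  M = x * x - P * (c * c)
  add-back : ∀ x P c → x * x ≡ (x * x - P * (c * c)) + P * (c * c)
  add-back = solve-∀
  subtract : ∀ x P c → c * c * P ≡ x * x - (x * x - P * (c * c))
  subtract = solve-∀
  h∣M : h ∣ M
  h∣M = ∣-trans (gcd∣ʳ P a) (∣-trans (∣m⇒∣m*n a ∣-refl) aa∣M)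
  h∣x : h ∣ x
  h∣x = ∣squarefree⇒∣x²⇒∣x sf (gcd∣ˡ P a)
    (subst (h ∣_) (sym (add-back x P c)) (∣m∣n⇒∣m+n h∣M (∣m⇒∣m*n (c * c) (gcd∣ˡ P a))))
  hh∣ccP : h * h ∣ c * c * P
  hh∣ccP = subst (h * h ∣_) (sym (subtract x P c))
    (∣m∣n⇒∣m-n (∣-trans (*-monoʳ-∣ h h∣x) (*-monoˡ-∣ x h∣x))
               (∣-trans (∣-trans (*-monoʳ-∣ h (gcd∣ʳ P a)) (*-monoˡ-∣ a (gcd∣ʳ P a))) aa∣M))
  hh∣P : h * h ∣ P
  hh∣P = coprime-divisor (coprime-sym (coprime-squares (coprime-∣ʳ c⊥a (gcd∣ʳ P a)))) hh∣ccP

4a+r≡4b+s⇒4∣r-s : ∀ {a b r s} → + 4 * a + r ≡ + 4 * b + s → + 4 ∣ r - s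
4a+r≡4b+s⇒4∣r-s {a} {b} {r} {s} eq = divides (b - a) (begin
  r - s                                         ≡⟨ split a b r s ⟩
  (+ 4 * a + r) - (+ 4 * b + s) + (b - a) * + 4  ≡⟨ cong (λ z → z - (+ 4 * b + s) + (b - a) * + 4) eq ⟩
  (+ 4 * b + s) - (+ 4 * b + s) + (b - a) * + 4  ≡⟨ cancel (+ 4 * b + s) ((b - a) * + 4) ⟩
  (b - a) * + 4                                 ∎)
  where
  open ≡-Reasoning
  split : ∀ a b r s → r - s ≡ (+ 4 * a + r) - (+ 4 * b + s) + (b - a) * + 4
  split = solve-∀
  cancel : ∀ p q → p - p + q ≡ q
  cancel = solve-∀

parity : ∀ z → ∃ λ q → z ≡ + 2 * q ⊎ z ≡ + 2 * q + 1ℤ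
parity z = by-remainder (z ℤDM.%ℕ 2) (ℤDM.n%ℕd<d z 2) (ℤDM.a≡a%ℕn+[a/ℕn]*n z 2)
  where
  q : ℤ
  q = z ℤDM./ℕ 2
  even : ∀ q → + 0 + q * + 2 ≡ + 2 * q
  even = solve-∀
  odd : ∀ q → + 1 + q * + 2 ≡ + 2 * q + 1ℤ
  odd = solve-∀
  by-remainder : ∀ r → r ℕ.< 2 → z ≡ + r + q * + 2 → ∃ λ q → z ≡ + 2 * q ⊎ z ≡ + 2 * q + 1ℤ
  by-remainder 0 _ eq = q , inj₁ (trans eq (even q))
  by-remainder 1 _ eq = q , inj₂ (trans eq (odd q))
  by-remainder (suc (suc _)) (s≤s (s≤s ())) _

4∣4w+c⇒4∣c : ∀ {z c} w → + 4 ∣ z → z ≡ + 4 * w + c → + 4 ∣ c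
4∣4w+c⇒4∣c w 4∣z refl = ∣m+n∣m⇒∣n 4∣z (∣m⇒∣m*n w ∣-refl)

¬4∣x²-[4t+r]y² : ∀ {x y t r} → ¬ + 4 ∣ - r → ¬ + 4 ∣ 1ℤ - r → Coprime x y →
                 ¬ + 4 ∣ x * x - (+ 4 * t + r) * (y * y)
¬4∣x²-[4t+r]y² {x} {y} {t} {r} 4∤-r 4∤1-r (u , v , eq) 4∣F = by-parity (parity x) (parity y)
  where
  k : ℤ
  k = + 4 * t + r
  F : ℤ → ℤ → ℤ
  F x y = x * x - k * (y * y)
  evens : ∀ u q v s → u * (+ 2 * q) + v * (+ 2 * s) ≡ (u * q + v * s) * + 2
  evens = solve-∀
  even-odd : ∀ q s t r → (+ 2 * q) * (+ 2 * q) - (+ 4 * t + r) * ((+ 2 * s + 1ℤ) * (+ 2 * s + 1ℤ))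
                        ≡ + 4 * (q * q - (+ 4 * t + r) * (s * s + s) - t) + - r
  even-odd = solve-∀
  odd-even : ∀ q s t r → (+ 2 * q + 1ℤ) * (+ 2 * q + 1ℤ) - (+ 4 * t + r) * ((+ 2 * s) * (+ 2 * s))
                        ≡ + 4 * (q * q + q - (+ 4 * t + r) * (s * s)) + 1ℤ
  odd-even = solve-∀
  odd-odd : ∀ q s t r → (+ 2 * q + 1ℤ) * (+ 2 * q + 1ℤ) - (+ 4 * t + r) * ((+ 2 * s + 1ℤ) * (+ 2 * s + 1ℤ))
                       ≡ + 4 * (q * q + q - (+ 4 * t + r) * (s * s + s) - t) + (1ℤ - r)
  odd-odd = solve-∀
  by-parity : (∃ λ q → x ≡ + 2 * q ⊎ x ≡ + 2 * q + 1ℤ) → (∃ λ s → y ≡ + 2 * s ⊎ y ≡ + 2 * s + 1ℤ) → ⊥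
  by-parity (q , inj₁ x≡) (s , inj₁ y≡) = from-no (+ 2 ∣? 1ℤ)
    (divides (u * q + v * s) (trans (sym eq) (trans (cong₂ (λ x y → u * x + v * y) x≡ y≡) (evens u q v s))))
  by-parity (q , inj₁ x≡) (s , inj₂ y≡) = 4∤-r (4∣4w+c⇒4∣c (q * q - k * (s * s + s) - t) 4∣F
    (trans (cong₂ F x≡ y≡) (even-odd q s t r)))
  by-parity (q , inj₂ x≡) (s , inj₁ y≡) = from-no (+ 4 ∣? 1ℤ) (4∣4w+c⇒4∣c (q * q + q - k * (s * s)) 4∣F
    (trans (cong₂ F x≡ y≡) (odd-even q s t r)))
  by-parity (q , inj₂ x≡) (s , inj₂ y≡) = 4∤1-r (4∣4w+c⇒4∣c (q * q + q - k * (s * s + s) - t) 4∣F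
    (trans (cong₂ F x≡ y≡) (odd-odd q s t r)))

¬4∣x²-ky² : ∀ {x y k} → (∃[ t ] k ≡ + 4 * t + + 2) ⊎ (∃[ t ] k ≡ + 4 * t + + 3) →
            Coprime x y → ¬ + 4 ∣ x * x - k * (y * y)
¬4∣x²-ky² (inj₁ (t , refl)) = ¬4∣x²-[4t+r]y² {t = t} (from-no (+ 4 ∣? - + 2)) (from-no (+ 4 ∣? 1ℤ - + 2))
¬4∣x²-ky² (inj₂ (t , refl)) = ¬4∣x²-[4t+r]y² {t = t} (from-no (+ 4 ∣? - + 3)) (from-no (+ 4 ∣? 1ℤ - + 3))

x²-ky²≡a^[2+j]⇒coprime[2,a] : ∀ {x y k a j} →
  (∃[ t ] k ≡ + 4 * t + + 2) ⊎ (∃[ t ] k ≡ + 4 * t + + 3) →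
  Coprime x y → x * x - k * (y * y) ≡ a ^ suc (suc j) → Coprime (+ 2) a
x²-ky²≡a^[2+j]⇒coprime[2,a] {a = a} {j} k-mod x⊥y eq = by-parity (parity a)
  where
  odd : ∀ q → - q * + 2 + 1ℤ * (+ 2 * q + 1ℤ) ≡ 1ℤ
  odd = solve-∀
  four : ∀ q → + 2 * q * (+ 2 * q) ≡ q * q * + 4
  four = solve-∀
  by-parity : (∃ λ q → a ≡ + 2 * q ⊎ a ≡ + 2 * q + 1ℤ) → Coprime (+ 2) a
  by-parity (q , inj₁ refl) = ⊥-elim (¬4∣x²-ky² k-mod x⊥y
    (subst (+ 4 ∣_) (sym eq) (∣-trans (divides (q * q) (four q)) (a*a∣a^[2+k] (+ 2 * q) j))))
  by-parity (q , inj₂ refl) = - q , 1ℤ , odd q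

norm : ℤ → ℤ → 𝒪 → ℤ
norm m σ (x , y) = Q₀ m σ x y

infix 4 _∣𝒪_
_∣𝒪_ : ℤ → 𝒪 → Set
c ∣𝒪 (x , y) = (c ∣ x) × (c ∣ y)

module _ (m σ : ℤ) where

  norm-mul : ∀ α β → norm m σ (mul𝒪 m σ α β) ≡ norm m σ α * norm m σ β
  norm-mul (B₁ , C₁) (B₂ , C₂) = expand m σ B₁ C₁ B₂ C₂
    where
    expand : ∀ m σ B₁ C₁ B₂ C₂ →
        (B₁ * B₂ + m * C₁ * C₂) * (B₁ * B₂ + m * C₁ * C₂)
      + σ * (B₁ * B₂ + m * C₁ * C₂) * (B₁ * C₂ + B₂ * C₁ + σ * C₁ * C₂)
      - m * (B₁ * C₂ + B₂ * C₁ + σ * C₁ * C₂) * (B₁ * C₂ + B₂ * C₁ + σ * C₁ * C₂)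
      ≡ (B₁ * B₁ + σ * B₁ * C₁ - m * C₁ * C₁) * (B₂ * B₂ + σ * B₂ * C₂ - m * C₂ * C₂)
    expand = solve-∀

  mul𝒪-comm : ∀ α β → mul𝒪 m σ α β ≡ mul𝒪 m σ β α
  mul𝒪-comm (B₁ , C₁) (B₂ , C₂) = cong₂ _,_ (first m B₁ C₁ B₂ C₂) (second σ B₁ C₁ B₂ C₂)
    where
    first : ∀ m B₁ C₁ B₂ C₂ → B₁ * B₂ + m * C₁ * C₂ ≡ B₂ * B₁ + m * C₂ * C₁
    first = solve-∀
    second : ∀ σ B₁ C₁ B₂ C₂ → B₁ * C₂ + B₂ * C₁ + σ * C₁ * C₂ ≡ B₂ * C₁ + B₁ * C₂ + σ * C₂ * C₁
    second = solve-∀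

  norm-scale : ∀ g α → norm m σ (scale g α) ≡ g * g * norm m σ α
  norm-scale g (x , y) = expand m σ g x y
    where
    expand : ∀ m σ g x y → g * x * (g * x) + σ * (g * x) * (g * y) - m * (g * y) * (g * y)
                         ≡ g * g * (x * x + σ * x * y - m * y * y)
    expand = solve-∀

  coprime[norm,C] : ∀ {B C} → Coprime B C → Coprime (Q₀ m σ B C) C
  coprime[norm,C] {B} {C} B⊥C = subst (λ z → Coprime z C) (sym (split m σ B C))
    (coprime-+∣ (coprime-*ˡ B⊥C B⊥C) (∣m⇒∣m*n (σ * B - m * C) ∣-refl))
    where
    split : ∀ m σ B C → B * B + σ * B * C - m * C * C ≡ B * B + C * (σ * B - m * C)
    split = solve-∀

  coprime[C,A] : ∀ {k A B C} → InS (suc k) m σ A B C → Coprime C A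
  coprime[C,A] {k} {A} {B} (N≡ , gcd≡1) =
    coprime-∣ʳ (coprime-sym (coprime[norm,C] {B} (gcd≡1⇒coprime gcd≡1)))
      (subst (A ∣_) (sym N≡) (a∣a^[1+k] A k))

  -- Coordinatewise form of ᾱ₁ · α₁α₂ = N(α₁) α₂.
  ∣𝒪-mul⇒∣-norm : ∀ {c B₁ C₁ B₂ C₂} → Coprime B₂ C₂ →
                  c ∣𝒪 mul𝒪 m σ (B₁ , C₁) (B₂ , C₂) → c ∣ Q₀ m σ B₁ C₁
  ∣𝒪-mul⇒∣-norm {c} {B₁} {C₁} {B₂} {C₂} B₂⊥C₂ (c∣X , c∣Y) = coprime-factors B₂⊥C₂
    (subst (c ∣_) (sym (times-B₂ m σ B₁ C₁ B₂ C₂))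
      (∣m∣n⇒∣m-n (∣m⇒∣m*n (B₁ + σ * C₁) c∣X) (∣m⇒∣m*n C₁ (∣n⇒∣m*n m c∣Y))))
    (subst (c ∣_) (sym (times-C₂ m σ B₁ C₁ B₂ C₂))
      (∣m∣n⇒∣m-n (∣m⇒∣m*n B₁ c∣Y) (∣m⇒∣m*n C₁ c∣X)))
    where
    times-B₂ : ∀ m σ B₁ C₁ B₂ C₂ → (B₁ * B₁ + σ * B₁ * C₁ - m * C₁ * C₁) * B₂
      ≡ (B₁ * B₂ + m * C₁ * C₂) * (B₁ + σ * C₁) - m * (B₁ * C₂ + B₂ * C₁ + σ * C₁ * C₂) * C₁
    times-B₂ = solve-∀
    times-C₂ : ∀ m σ B₁ C₁ B₂ C₂ → (B₁ * B₁ + σ * B₁ * C₁ - m * C₁ * C₁) * C₂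
      ≡ (B₁ * C₂ + B₂ * C₁ + σ * C₁ * C₂) * B₁ - (B₁ * B₂ + m * C₁ * C₂) * C₁
    times-C₂ = solve-∀

  disc-identity : σ * σ ≡ σ → ∀ B C →
    (+ 2 * B + σ * C) * (+ 2 * B + σ * C) ≡ Disc m σ * (C * C) + + 4 * Q₀ m σ B C
  disc-identity σσ≡σ B C = trans (expand m σ B C)
    (cong (λ s → (+ 4 * m + s) * (C * C) + + 4 * Q₀ m σ B C) σσ≡σ)
    where
    expand : ∀ m σ B C → (+ 2 * B + σ * C) * (+ 2 * B + σ * C)
           ≡ (+ 4 * m + σ * σ) * (C * C) + + 4 * (B * B + σ * B * C - m * C * C)
    expand = solve-∀

  coprime-2B+σC : ∀ {B C d} → σ * σ ≡ σ → Coprime (Disc m σ) d → Coprime C d →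
                  d ∣ Q₀ m σ B C → Coprime (+ 2 * B + σ * C) d
  coprime-2B+σC {B} {C} σσ≡σ Δ⊥d C⊥d d∣N = coprime-*⇒coprimeˡ
    (subst (λ z → Coprime z _) (sym (disc-identity σσ≡σ B C))
      (coprime-+∣ (coprime-*ˡ Δ⊥d (coprime-*ˡ C⊥d C⊥d)) (∣n⇒∣m*n (+ 4) d∣N)))

  coprime-cross-term : ∀ {k A₁ B₁ C₁ A₂ B₂ C₂ d} → σ * σ ≡ σ →
    InS (suc k) m σ A₁ B₁ C₁ → InS (suc k) m σ A₂ B₂ C₂ → Coprime (Disc m σ) d →
    d ∣ A₁ → d ∣ A₂ → d ∣ B₁ * C₂ + B₂ * C₁ + σ * C₁ * C₂ →
    Coprime (B₁ * C₂ - B₂ * C₁) d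
  coprime-cross-term {k} {A₁} {B₁} {C₁} {A₂} {B₂} {C₂} {d} σσ≡σ P₁@(N₁≡ , _) P₂ Δ⊥d d∣A₁ d∣A₂ d∣Y =
    subst (λ z → Coprime z d) (sym (split σ B₁ C₁ B₂ C₂))
      (coprime-+∣ {(+ 2 * B₁ + σ * C₁) * C₂}
        (coprime-*ˡ {+ 2 * B₁ + σ * C₁} (coprime-2B+σC {B₁} σσ≡σ Δ⊥d C₁⊥d d∣N₁) C₂⊥d)
        (∣m⇒∣-m d∣Y))
    where
    split : ∀ σ B₁ C₁ B₂ C₂ → B₁ * C₂ - B₂ * C₁
          ≡ (+ 2 * B₁ + σ * C₁) * C₂ + - (B₁ * C₂ + B₂ * C₁ + σ * C₁ * C₂)
    split = solve-∀
    d∣N₁ : d ∣ Q₀ m σ B₁ C₁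
    d∣N₁ = subst (d ∣_) (sym N₁≡) (∣-trans d∣A₁ (a∣a^[1+k] A₁ k))
    C₁⊥d : Coprime C₁ d
    C₁⊥d = coprime-∣ʳ (coprime[C,A] {k} {A₁} {B₁} P₁) d∣A₁
    C₂⊥d : Coprime C₂ d
    C₂⊥d = coprime-∣ʳ (coprime[C,A] {k} {A₂} {B₂} P₂) d∣A₂

  ^∣𝒪-mul : ∀ {k A₁ B₁ C₁ A₂ B₂ C₂ d} → σ * σ ≡ σ →
    InS (suc k) m σ A₁ B₁ C₁ → InS (suc k) m σ A₂ B₂ C₂ → Coprime (Disc m σ) d →
    d ∣ A₁ → d ∣ A₂ → d ∣ B₁ * C₂ + B₂ * C₁ + σ * C₁ * C₂ →
    d ^ suc k ∣𝒪 mul𝒪 m σ (B₁ , C₁) (B₂ , C₂)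
  ^∣𝒪-mul {k} {A₁} {B₁} {C₁} {A₂} {B₂} {C₂} {d} σσ≡σ P₁@(N₁≡ , _) P₂@(N₂≡ , _) Δ⊥d d∣A₁ d∣A₂ d∣Y =
    dⁿ∣X , dⁿ∣Y
    where
    n : ℕ
    n = suc k
    X : ℤ
    X = B₁ * B₂ + m * C₁ * C₂
    Y : ℤ
    Y = B₁ * C₂ + B₂ * C₁ + σ * C₁ * C₂
    cross-term-Y : ∀ m σ B₁ C₁ B₂ C₂ → (B₁ * C₂ - B₂ * C₁) * (B₁ * C₂ + B₂ * C₁ + σ * C₁ * C₂)
      ≡ C₂ * C₂ * (B₁ * B₁ + σ * B₁ * C₁ - m * C₁ * C₁) - C₁ * C₁ * (B₂ * B₂ + σ * B₂ * C₂ - m * C₂ * C₂)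
    cross-term-Y = solve-∀
    C₁-X : ∀ m σ B₁ C₁ B₂ C₂ → C₁ * (B₁ * B₂ + m * C₁ * C₂)
      ≡ B₁ * (B₁ * C₂ + B₂ * C₁ + σ * C₁ * C₂) - C₂ * (B₁ * B₁ + σ * B₁ * C₁ - m * C₁ * C₁)
    C₁-X = solve-∀
    dⁿ∣N₁ : d ^ n ∣ Q₀ m σ B₁ C₁
    dⁿ∣N₁ = subst (d ^ n ∣_) (sym N₁≡) (∣-^ n d∣A₁)
    dⁿ∣N₂ : d ^ n ∣ Q₀ m σ B₂ C₂
    dⁿ∣N₂ = subst (d ^ n ∣_) (sym N₂≡) (∣-^ n d∣A₂)
    dⁿ∣Y : d ^ n ∣ Y
    dⁿ∣Y = coprime-divisor
      (coprime-sym (coprime-^ʳ n (coprime-cross-term {k} {A₁} {B₁} {C₁} {A₂} {B₂} {C₂}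
                                    σσ≡σ P₁ P₂ Δ⊥d d∣A₁ d∣A₂ d∣Y)))
      (subst (d ^ n ∣_) (sym (cross-term-Y m σ B₁ C₁ B₂ C₂))
        (∣m∣n⇒∣m-n (∣n⇒∣m*n (C₂ * C₂) dⁿ∣N₁) (∣n⇒∣m*n (C₁ * C₁) dⁿ∣N₂)))
    dⁿ∣X : d ^ n ∣ X
    dⁿ∣X = coprime-divisor
      (coprime-sym (coprime-^ʳ n (coprime-∣ʳ (coprime[C,A] {k} {A₁} {B₁} P₁) d∣A₁)))
      (subst (d ^ n ∣_) (sym (C₁-X m σ B₁ C₁ B₂ C₂))
        (∣m∣n⇒∣m-n (∣n⇒∣m*n B₁ dⁿ∣Y) (∣n⇒∣m*n C₂ dⁿ∣N₁)))

  gcd-mul≡^ : ∀ {k A₁ B₁ C₁ A₂ B₂ C₂} → σ * σ ≡ σ →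
    InS (suc k) m σ A₁ B₁ C₁ → InS (suc k) m σ A₂ B₂ C₂ → Coprime (Disc m σ) A₁ → A₂ ≢ 0ℤ →
    ∃ λ e → 1 ℕ.≤ e
          × + (e ℕ.^ suc k) ≡ gcd (B₁ * B₂ + m * C₁ * C₂) (B₁ * C₂ + B₂ * C₁ + σ * C₁ * C₂)
          × (+ e ∣ A₁) × (+ e ∣ A₂)
  gcd-mul≡^ {k} {A₁} {B₁} {C₁} {A₂} {B₂} {C₂} σσ≡σ P₁@(N₁≡ , gcd₁) P₂@(N₂≡ , gcd₂) Δ⊥A₁ A₂≢0 =
    ∣ d ∣ , 1≤∣d∣ , sym g≡∣d∣ⁿ , d∣A₁ , d∣A₂
    where
    n : ℕ
    n = suc k
    X : ℤ
    X = B₁ * B₂ + m * C₁ * C₂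
    Y : ℤ
    Y = B₁ * C₂ + B₂ * C₁ + σ * C₁ * C₂
    g : ℤ
    g = gcd X Y
    d : ℤ
    d = gcd (gcd A₁ A₂) Y
    d∣A₁ : d ∣ A₁
    d∣A₁ = ∣-trans (gcd∣ˡ (gcd A₁ A₂) Y) (gcd∣ˡ A₁ A₂)
    d∣A₂ : d ∣ A₂
    d∣A₂ = ∣-trans (gcd∣ˡ (gcd A₁ A₂) Y) (gcd∣ʳ A₁ A₂)
    dⁿ∣g : d ^ n ∣ g
    dⁿ∣g = let dⁿ∣X , dⁿ∣Y = ^∣𝒪-mul {k} {A₁} {B₁} {C₁} {A₂} {B₂} {C₂} σσ≡σ P₁ P₂
                                (coprime-∣ʳ Δ⊥A₁ d∣A₁) d∣A₁ d∣A₂ (gcd∣ʳ (gcd A₁ A₂) Y)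
           in gcd-greatest dⁿ∣X dⁿ∣Y
    g∣N₁ : g ∣ Q₀ m σ B₁ C₁
    g∣N₁ = ∣𝒪-mul⇒∣-norm {g} {B₁} {C₁} {B₂} {C₂} (gcd≡1⇒coprime gcd₂) (gcd∣ˡ X Y , gcd∣ʳ X Y)
    g∣N₂ : g ∣ Q₀ m σ B₂ C₂
    g∣N₂ = ∣𝒪-mul⇒∣-norm {g} {B₂} {C₂} {B₁} {C₁} (gcd≡1⇒coprime gcd₁)
      (subst (g ∣𝒪_) (mul𝒪-comm (B₁ , C₁) (B₂ , C₂)) (gcd∣ˡ X Y , gcd∣ʳ X Y))
    g∣dⁿ : g ∣ d ^ n
    g∣dⁿ = ∣gcd-^ {g} {gcd A₁ A₂} {Y} n
      (∣gcd-^ {g} {A₁} {A₂} n (subst (g ∣_) N₁≡ g∣N₁) (subst (g ∣_) N₂≡ g∣N₂))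
      (∣-trans (gcd∣ʳ X Y) (a∣a^[1+k] Y k))
    g≡∣d∣ⁿ : g ≡ + (∣ d ∣ ℕ.^ n)
    g≡∣d∣ⁿ = cong +_ (ℕD.∣-antisym (∣⇒∣ᵤ (subst (g ∣_) (pos-^ ∣ d ∣ n) g∣dⁿ))
                                    (∣⇒∣ᵤ (subst (_∣ g) (pos-^ ∣ d ∣ n) dⁿ∣g)))
    1≤∣d∣ : 1 ℕ.≤ ∣ d ∣
    1≤∣d∣ = ℕP.n≢0⇒n>0 λ ∣d∣≡0 → A₂≢0 (ℤP.i^n≡0⇒i≡0 A₂ n (trans (sym N₂≡)
      (0∣⇒≡0 (subst (_∣ Q₀ m σ B₂ C₂) (trans g≡∣d∣ⁿ (cong (λ z → + (z ℕ.^ n)) ∣d∣≡0)) g∣N₂))))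

  norm-of-quotient : ∀ {n A₁ B₁ C₁ A₂ B₂ C₂ a₁ a₂ E x y} →
    Q₀ m σ B₁ C₁ ≡ A₁ ^ n → Q₀ m σ B₂ C₂ ≡ A₂ ^ n → A₁ ≡ a₁ * E → A₂ ≡ a₂ * E →
    B₁ * B₂ + m * C₁ * C₂ ≡ x * E ^ n → B₁ * C₂ + B₂ * C₁ + σ * C₁ * C₂ ≡ y * E ^ n →
    E ^ n ≢ 0ℤ → Q₀ m σ x y ≡ (a₁ * a₂) ^ n
  norm-of-quotient {n} {A₁} {B₁} {C₁} {A₂} {B₂} {C₂} {a₁} {a₂} {E} {x} {y} N₁≡ N₂≡ A₁≡ A₂≡ X≡ Y≡ Eⁿ≢0 =
    ℤP.*-cancelˡ-≡ (G * G) _ _ {{≢-nonZero G*G≢0}} (begin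
      G * G * Q₀ m σ x y                    ≡⟨ norm-scale G (x , y) ⟨
      Q₀ m σ (G * x) (G * y)                ≡⟨ cong₂ (Q₀ m σ) (trans (ℤP.*-comm G x) (sym X≡))
                                                              (trans (ℤP.*-comm G y) (sym Y≡)) ⟩
      norm m σ (mul𝒪 m σ (B₁ , C₁) (B₂ , C₂)) ≡⟨ norm-mul (B₁ , C₁) (B₂ , C₂) ⟩
      Q₀ m σ B₁ C₁ * Q₀ m σ B₂ C₂           ≡⟨ cong₂ _*_ N₁≡ N₂≡ ⟩
      A₁ ^ n * A₂ ^ n                       ≡⟨ cong₂ (λ u v → u ^ n * v ^ n) A₁≡ A₂≡ ⟩
      (a₁ * E) ^ n * (a₂ * E) ^ n           ≡⟨ cong₂ _*_ (^-distribʳ-* a₁ E n) (^-distribʳ-* a₂ E n) ⟩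
      a₁ ^ n * G * (a₂ ^ n * G)             ≡⟨ rearrange (a₁ ^ n) (a₂ ^ n) G ⟩
      G * G * (a₁ ^ n * a₂ ^ n)             ≡⟨ cong (G * G *_) (^-distribʳ-* a₁ a₂ n) ⟨
      G * G * (a₁ * a₂) ^ n                 ∎)
    where
    open ≡-Reasoning
    G : ℤ
    G = E ^ n
    rearrange : ∀ p q G → p * G * (q * G) ≡ G * G * (p * q)
    rearrange = solve-∀
    G*G≢0 : G * G ≢ 0ℤ
    G*G≢0 GG≡0 = [ Eⁿ≢0 , Eⁿ≢0 ]′ (ℤP.i*j≡0⇒i≡0∨j≡0 G GG≡0)

  Composition : ℕ → ℤ → ℤ → ℤ → ℤ → ℤ → ℤ → ℕ → Set
  Composition n A₁ B₁ C₁ A₂ B₂ C₂ e =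
    Σ ℤ λ A₃ → Σ ℤ λ B₃ → Σ ℤ λ C₃ →
      (+ (e ℕ.^ 2) * A₃ ≡ A₁ * A₂)
      × (+ (e ℕ.^ n) * B₃ ≡ B₁ * B₂ + m * C₁ * C₂)
      × (+ (e ℕ.^ n) * C₃ ≡ B₁ * C₂ + B₂ * C₁ + σ * C₁ * C₂)
      × InS n m σ A₃ B₃ C₃
      × SameClass n (B₃ , C₃) (mul𝒪 m σ (B₁ , C₁) (B₂ , C₂))

  composition : ∀ {n A₁ B₁ C₁ A₂ B₂ C₂ e} → 1 ℕ.≤ e →
    InS n m σ A₁ B₁ C₁ → InS n m σ A₂ B₂ C₂ →
    + (e ℕ.^ n) ≡ gcd (B₁ * B₂ + m * C₁ * C₂) (B₁ * C₂ + B₂ * C₁ + σ * C₁ * C₂) →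
    + e ∣ A₁ → + e ∣ A₂ → Composition n A₁ B₁ C₁ A₂ B₂ C₂ e
  composition {n} {A₁} {B₁} {C₁} {A₂} {B₂} {C₂} {e} 1≤e (N₁≡ , _) (N₂≡ , _) eⁿ≡g
              (divides a₁ A₁≡) (divides a₂ A₂≡) =
    compose (gcd-quotients X Y g≢0)
    where
    open ≡-Reasoning
    X : ℤ
    X = B₁ * B₂ + m * C₁ * C₂
    Y : ℤ
    Y = B₁ * C₂ + B₂ * C₁ + σ * C₁ * C₂
    g : ℤ
    g = gcd X Y
    Eⁿ≡g : (+ e) ^ n ≡ g
    Eⁿ≡g = trans (pos-^ e n) eⁿ≡g
    g≢0 : g ≢ 0ℤ
    g≢0 g≡0 = ℕ.≢-nonZero⁻¹ (e ℕ.^ n) {{ℕP.m^n≢0 e n {{ℕ.>-nonZero 1≤e}}}}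
                (ℤP.+-injective (trans eⁿ≡g g≡0))
    over-Eⁿ : ∀ {Z z} → Z ≡ z * g → Z ≡ z * (+ e) ^ n
    over-Eⁿ {z = z} Z≡ = trans Z≡ (cong (z *_) (sym Eⁿ≡g))
    eⁿ*-quotient : ∀ {Z z} → Z ≡ z * g → + (e ℕ.^ n) * z ≡ Z
    eⁿ*-quotient {z = z} refl = trans (cong (_* z) eⁿ≡g) (ℤP.*-comm g z)
    same-class : ∀ {Z z} → Z ≡ z * g → + (e ℕ.^ n) * z ≡ + (1 ℕ.^ n) * Z
    same-class {Z} Z≡ = trans (eⁿ*-quotient Z≡)
      (sym (trans (cong (λ u → + u * Z) (ℕP.^-zeroˡ n)) (ℤP.*-identityˡ Z)))
    square : ∀ E a₁ a₂ → E * (E * 1ℤ) * (a₁ * a₂) ≡ a₁ * E * (a₂ * E)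
    square = solve-∀
    e²A₃≡A₁A₂ : + (e ℕ.^ 2) * (a₁ * a₂) ≡ A₁ * A₂
    e²A₃≡A₁A₂ = begin
      + (e ℕ.^ 2) * (a₁ * a₂)          ≡⟨ cong (_* (a₁ * a₂)) (pos-^ e 2) ⟨
      + e * (+ e * 1ℤ) * (a₁ * a₂)     ≡⟨ square (+ e) a₁ a₂ ⟩
      a₁ * + e * (a₂ * + e)            ≡⟨ cong₂ _*_ A₁≡ A₂≡ ⟨
      A₁ * A₂                          ∎
    compose : (∃₂ λ x′ y′ → X ≡ x′ * g × Y ≡ y′ * g × Coprime x′ y′) →
              Composition n A₁ B₁ C₁ A₂ B₂ C₂ e
    compose (x′ , y′ , X≡ , Y≡ , x′⊥y′) =
      a₁ * a₂ , x′ , y′ , e²A₃≡A₁A₂ , eⁿ*-quotient X≡ , eⁿ*-quotient Y≡ ,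
      (norm-of-quotient {n} {A₁} {B₁} {C₁} {A₂} {B₂} {C₂} {a₁} {a₂} {+ e} {x′} {y′}
         N₁≡ N₂≡ A₁≡ A₂≡ (over-Eⁿ {z = x′} X≡) (over-Eⁿ {z = y′} Y≡)
         (λ Eⁿ≡0 → g≢0 (trans (sym Eⁿ≡g) Eⁿ≡0))
       , coprime⇒gcd≡1 x′⊥y′) ,
      (e , 1 , 1≤e , ℕP.≤-refl , cong₂ _,_ (same-class X≡) (same-class Y≡))

σ*σ≡σ : ∀ {σ} → σ ≡ 0ℤ ⊎ σ ≡ 1ℤ → σ * σ ≡ σ
σ*σ≡σ (inj₁ refl) = refl
σ*σ≡σ (inj₂ refl) = refl

disc≢-1 : ∀ {m σ} → σ ≡ 0ℤ ⊎ σ ≡ 1ℤ → Disc m σ ≢ -1ℤ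
disc≢-1 {m} (inj₁ refl) Δ≡-1 = from-no (+ 4 ∣? 0ℤ - + 3) (4a+r≡4b+s⇒4∣r-s {m} { -1ℤ} {0ℤ} {+ 3} Δ≡-1)
disc≢-1 {m} (inj₂ refl) Δ≡-1 = from-no (+ 4 ∣? 1ℤ - + 3) (4a+r≡4b+s⇒4∣r-s {m} { -1ℤ} {1ℤ} {+ 3} Δ≡-1)

coprime[Δ,A]⇒A≢0 : ∀ {m σ A} → σ ≡ 0ℤ ⊎ σ ≡ 1ℤ → Disc m σ ≢ 1ℤ → Coprime (Disc m σ) A → A ≢ 0ℤ
coprime[Δ,A]⇒A≢0 {m} {σ} σ∈01 Δ≢1 Δ⊥A refl = unit (Disc m σ) refl (coprime[a,0]⇒∣a∣≡1 Δ⊥A)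
  where
  unit : ∀ z → Disc m σ ≡ z → ∣ z ∣ ≡ 1 → ⊥
  unit (+ 1)              Δ≡1  _ = Δ≢1 Δ≡1
  unit -[1+ 0 ]           Δ≡-1 _ = disc≢-1 {m} σ∈01 Δ≡-1
  unit (+ 0)              _ ()
  unit (+ suc (suc _))    _ ()
  unit -[1+ suc _ ]       _ ()

coprime[Δ,A] : ∀ {m σ A B C} k → σ ≡ 0ℤ ⊎ σ ≡ 1ℤ → IsFundamentalDiscriminant (Disc m σ) →
               InS (suc (suc k)) m σ A B C → Coprime (Disc m σ) A
coprime[Δ,A] {m} k (inj₁ refl) (_ , inj₁ ((t , Δ≡) , _)) _ =
  ⊥-elim (from-no (+ 4 ∣? 0ℤ - 1ℤ) (4a+r≡4b+s⇒4∣r-s {m} {t} {0ℤ} {1ℤ} Δ≡))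
coprime[Δ,A] {m} k (inj₂ refl) (_ , inj₂ (k′ , Δ≡ , _)) _ =
  ⊥-elim (from-no (+ 4 ∣? 1ℤ - 0ℤ)
    (4a+r≡4b+s⇒4∣r-s {m} {k′} {1ℤ} {0ℤ} (trans Δ≡ (sym (ℤP.+-identityʳ (+ 4 * k′))))))
coprime[Δ,A] {m} {A = A} {B} {C} k (inj₂ refl) (_ , inj₁ (_ , sf)) P@(N≡ , _) =
  a²∣x²-Pc²⇒coprime[P,a] {Disc m 1ℤ} {A} {C} {+ 2 * B + C} sf (coprime[C,A] m 1ℤ {suc k} {A} {B} P)
    (subst (A * A ∣_) (four-norm m B C) (∣n⇒∣m*n (+ 4) (subst (A * A ∣_) (sym N≡) (a*a∣a^[2+k] A k))))
  where
  four-norm : ∀ m B C → + 4 * (B * B + 1ℤ * B * C - m * C * C)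
            ≡ (+ 2 * B + C) * (+ 2 * B + C) - (+ 4 * m + 1ℤ) * (C * C)
  four-norm = solve-∀
coprime[Δ,A] {m} {A = A} {B} {C} k (inj₁ refl) (_ , inj₂ (k′ , Δ≡ , k′-mod , sf)) P@(N≡ , gcd≡1)
  with ℤP.*-cancelˡ-≡ (+ 4) m k′ (trans (sym (ℤP.+-identityʳ (+ 4 * m))) Δ≡)
... | refl = subst (λ z → Coprime z A) (four m) (coprime-*ˡ (coprime-*ˡ 2⊥A 2⊥A) m⊥A)
  where
  norm-σ=0 : ∀ m B C → B * B + 0ℤ * B * C - m * C * C ≡ B * B - m * (C * C)
  norm-σ=0 = solve-∀
  four : ∀ m → + 2 * + 2 * m ≡ + 4 * m + 0ℤ
  four = solve-∀
  B²-mC²≡ : B * B - m * (C * C) ≡ A ^ suc (suc k)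
  B²-mC²≡ = trans (sym (norm-σ=0 m B C)) N≡
  2⊥A : Coprime (+ 2) A
  2⊥A = x²-ky²≡a^[2+j]⇒coprime[2,a] {B} {C} {m} {A} {k} k′-mod (gcd≡1⇒coprime gcd≡1) B²-mC²≡
  m⊥A : Coprime m A
  m⊥A = a²∣x²-Pc²⇒coprime[P,a] {m} {A} {C} {B} sf (coprime[C,A] m 0ℤ {suc k} {A} {B} P)
    (subst (A * A ∣_) (sym B²-mC²≡) (a*a∣a^[2+k] A k))

^-injectiveˡ : ∀ {a b} k → a ℕ.^ suc k ≡ b ℕ.^ suc k → a ≡ b
^-injectiveˡ {a} {b} k eq with ℕP.<-cmp a b
... | tri< a<b _ _ = ⊥-elim (ℕP.<-irrefl eq (ℕP.^-monoˡ-< (suc k) a<b))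
... | tri≈ _ a≡b _ = a≡b
... | tri> _ _ b<a = ⊥-elim (ℕP.<-irrefl (sym eq) (ℕP.^-monoˡ-< (suc k) b<a))

proposition5 :
    (n : ℕ) → 2 ℕ.≤ n →
    (m σ : ℤ) → (σ ≡ 0ℤ ⊎ σ ≡ 1ℤ) → IsFundamentalDiscriminant (Disc m σ) →
    (A₁ B₁ C₁ A₂ B₂ C₂ : ℤ) →
    InS n m σ A₁ B₁ C₁ → InS n m σ A₂ B₂ C₂ →
    (Σ ℕ λ e → 1 ℕ.≤ e ×
        + (e ℕ.^ n) ≡ gcd (B₁ * B₂ + m * C₁ * C₂) (B₁ * C₂ + B₂ * C₁ + σ * C₁ * C₂))
    ×
    ((e : ℕ) → 1 ℕ.≤ e →
        + (e ℕ.^ n) ≡ gcd (B₁ * B₂ + m * C₁ * C₂) (B₁ * C₂ + B₂ * C₁ + σ * C₁ * C₂) →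
        Σ ℤ λ A₃ → Σ ℤ λ B₃ → Σ ℤ λ C₃ →
          (+ (e ℕ.^ 2) * A₃ ≡ A₁ * A₂)
          × (+ (e ℕ.^ n) * B₃ ≡ B₁ * B₂ + m * C₁ * C₂)
          × (+ (e ℕ.^ n) * C₃ ≡ B₁ * C₂ + B₂ * C₁ + σ * C₁ * C₂)
          × InS n m σ A₃ B₃ C₃
          × SameClass n (B₃ , C₃) (mul𝒪 m σ (B₁ , C₁) (B₂ , C₂)))
proposition5 (suc (suc k)) (s≤s (s≤s z≤n)) m σ σ∈01 fund@(Δ≢1 , _) A₁ B₁ C₁ A₂ B₂ C₂ P₁ P₂ =
  let e , 1≤e , eⁿ≡g , e∣A₁ , e∣A₂ =
        gcd-mul≡^ m σ {suc k} {A₁} {B₁} {C₁} {A₂} {B₂} {C₂} (σ*σ≡σ σ∈01) P₁ P₂ Δ⊥A₁ A₂≢0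
  in (e , 1≤e , eⁿ≡g) , λ e′ 1≤e′ e′ⁿ≡g →
    let e≡e′ = ^-injectiveˡ (suc k) (ℤP.+-injective (trans eⁿ≡g (sym e′ⁿ≡g)))
    in composition m σ {suc (suc k)} {A₁} {B₁} {C₁} {A₂} {B₂} {C₂} 1≤e′ P₁ P₂ e′ⁿ≡g
         (subst (λ z → + z ∣ A₁) e≡e′ e∣A₁) (subst (λ z → + z ∣ A₂) e≡e′ e∣A₂)
  where
  Δ⊥A₁ : Coprime (Disc m σ) A₁
  Δ⊥A₁ = coprime[Δ,A] {m} {σ} {A₁} {B₁} {C₁} k σ∈01 fund P₁
  A₂≢0 : A₂ ≢ 0ℤ
  A₂≢0 = coprime[Δ,A]⇒A≢0 {m} {σ} σ∈01 Δ≢1 (coprime[Δ,A] {m} {σ} {A₂} {B₂} {C₂} k σ∈01 fund P₂)
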